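{- Let $(\mathcal{A},\mathcal{T})$ be an ALF instance with $\mathcal{A} = (\mathcal{C}, \mathcal{H}, (\mathcal{S},\sqsubseteq_\mathrm{s},\sqcup,\bot_\mathrm{s}), \gamma, \kappa)$ such that $\mathcal{T}$ is realizable, let $\preceq$ be a complexity ordering on $\mathcal{H}$, and let $\lambda$ be a $\preceq$-Occam learner. Then $\lambda$ converges, i.e., for every teacher $\tau$ for $(\mathcal{A},\mathcal{T})$ there is $n\in\mathbb{N}$ with $\gamma(\lambda(S_{\tau,\lambda}^n))\in\mathcal{T}$. Furthermore, the hypothesis $\lambda(S_{\tau,\lambda}^n)$ to which the learner converges is a $\preceq$-minimal target element, i.e., there is no $H'\in\mathcal{H}$ with $\gamma(H')\in\mathcal{T}$, $H'\preceq\lambda(S_{\tau,\lambda}^n)$ and $\lambda(S_{\tau,\lambda}^n)\not\preceq H'$.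
   Context: An abstract learning framework (ALF) is a tuple $\mathcal{A} = (\mathcal{C}, \mathcal{H}, (\mathcal{S},\sqsubseteq_\mathrm{s},\sqcup,\bot_\mathrm{s}), \gamma, \kappa)$ where $\mathcal{C}$ (concept space) and $\mathcal{H}$ (hypothesis space) are classes, $(\mathcal{S},\sqsubseteq_\mathrm{s},\sqcup,\bot_\mathrm{s})$ (sample space) is a join semi-lattice with least element $\bot_\mathrm{s}$, $\gamma:\mathcal{H}\to\mathcal{C}$, and $\kappa:\mathcal{S}\to 2^{\mathcal{C}}$ satisfies $\kappa(\bot_\mathrm{s})=\mathcal{C}$ and $\kappa(S_1\sqcup S_2)=\kappa(S_1)\cap\kappa(S_2)$. Let $\kappa_\mathcal{H}(S)=\{H\in\mathcal{H}\mid\gamma(H)\in\kappa(S)\}$; $S$ is realizable if $\kappa_\mathcal{H}(S)\neq\emptyset$. An ALF instance is $(\mathcal{A},\mathcal{T})$ with $\mathcal{T}\subseteq\mathcal{C}$; $\mathcal{T}$ is realizable if $\gamma(H)\in\mathcal{T}$ for some $H\in\mathcal{H}$. A learner is a map $\lambda:\mathcal{S}\to\mathcal{H}$, consistent if $\gamma(\lambda(S))\in\kappa(S)$ for all realizable $S$. A teacher is a map $\tau:\mathcal{H}\to\mathcal{S}$ with (progress) $\tau(H)=\bot_\mathrm{s}$ if $\gamma(H)\in\mathcal{T}$ and $\gamma(H)\notin\kappa(\tau(H))$ if $\gamma(H)\notin\mathcal{T}$, and (honesty) $\mathcal{T}\subseteq\kappa(\tau(H))$ for all $H$. The sample sequence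 is $S_{\tau,\lambda}^0=\bot_\mathrm{s}$ and $S_{\tau,\lambda}^{n+1}=S_{\tau,\lambda}^n\sqcup\tau(\lambda(S_{\tau,\lambda}^n))$ for $n\in\mathbb{N}$. A complexity ordering is a total quasi-order (reflexive, transitive, and any two elements comparable) $\preceq$ on $\mathcal{H}$ such that $\{y\in\mathcal{H}\mid y\preceq x\}$ is finite for every $x\in\mathcal{H}$. A $\preceq$-Occam learner is a consistent learner $\lambda$ that always constructs a smallest consistent hypothesis, i.e., for every realizable sample $S$, $\lambda(S)\preceq H$ for all $H\in\kappa_\mathcal{H}(S)$. -}

module Defs where

open import Data.Nat using (ℕ; zero; suc)
open import Data.Product using (Σ; ∃; _×_; _,_)
open import Data.List using (List)
open import Data.Sum using (_⊎_)
open import Data.List.Membership.Propositional using (_∈_)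
open import Relation.Nullary using (¬_)
open import Relation.Binary.PropositionalEquality using (_≡_)
open import Relation.Binary.Lattice.Bundles using (BoundedJoinSemilattice)
open import Level using (0ℓ)

record ALF : Set₁ where
  field
    C   : Set
    H   : Set
    SL  : BoundedJoinSemilattice 0ℓ 0ℓ 0ℓ
  open BoundedJoinSemilattice SL public
    renaming (Carrier to S; _≤_ to _⊑_; _∨_ to _⊔_; ⊥ to ⊥s)
  field
    γ   : H → C
    κ   : S → C → Set
    κ-⊥ : ∀ c → κ ⊥s c
    κ-⊔→ : ∀ S₁ S₂ c → κ (S₁ ⊔ S₂) c → κ S₁ c × κ S₂ c
    κ-⊔← : ∀ S₁ S₂ c → κ S₁ c × κ S₂ c → κ (S₁ ⊔ S₂) c

module _ (A : ALF) where
  open ALF A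

  κH : S → H → Set
  κH s h = κ s (γ h)

  Realizable : S → Set
  Realizable s = ∃ λ h → κH s h

  TargetRealizable : (C → Set) → Set
  TargetRealizable T = ∃ λ h → T (γ h)

  Learner : Set
  Learner = S → H

  Consistent : Learner → Set
  Consistent λ′ = ∀ s → Realizable s → κ s (γ (λ′ s))

  record IsTeacher (T : C → Set) (τ : H → S) : Set where
    field
      progress-in  : ∀ h → T (γ h) → τ h ≡ ⊥s
      progress-out : ∀ h → ¬ T (γ h) → ¬ κ (τ h) (γ h)
      honesty      : ∀ h c → T c → κ (τ h) c

  sampleSeq : (τ : H → S) (λ′ : Learner) → ℕ → S
  sampleSeq τ λ′ zero    = ⊥s
  sampleSeq τ λ′ (suc n) = sampleSeq τ λ′ n ⊔ τ (λ′ (sampleSeq τ λ′ n))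

record ComplexityOrdering (H : Set) : Set₁ where
  field
    _⪯_     : H → H → Set
    ⪯-refl  : ∀ x → x ⪯ x
    ⪯-trans : ∀ {x y z} → x ⪯ y → y ⪯ z → x ⪯ z
    ⪯-total : ∀ x y → (x ⪯ y) ⊎ (y ⪯ x)
    ⪯-finite : ∀ x → ∃ λ (l : List H) → ∀ y → y ⪯ x → y ∈ l

module _ (A : ALF) where
  open ALF A

  IsOccam : ComplexityOrdering H → Learner A → Set
  IsOccam O λ′ =
    Consistent A λ′ ×
    (∀ s → Realizable A s → ∀ h → κH A s h → ComplexityOrdering._⪯_ O (λ′ s) h)

module Submission where

-- Fix a teacher τ and write Sⁿ for the sample sequence and hₙ = λ(Sⁿ) for the
-- hypotheses the learner proposes.  Honesty makes every target concept
-- consistent with every Sⁿ, and κ only shrinks along the sequence, since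
-- κ(Sⁿ⁺¹) = κ(Sⁿ) ∩ κ(τ(hₙ)).  Two consequences drive the proof:
--   * a non-target hₙ is refuted by τ(hₙ) and hence by every later sample, so
--     a hypothesis that is proposed twice cannot be a non-target (¬¬ target);
--   * an Occam learner only proposes hypotheses ⪯ some fixed target hypothesis
--     h*, and these lie in the finite down-set of h*, so by the pigeonhole
--     principle some hypothesis is proposed twice.
-- Excluded middle turns "not a non-target" into "target", giving convergence.
-- Minimality is immediate: the Occam learner's output is ⪯ every target
-- hypothesis, since all of them are consistent with the current sample.

open import Defs
open import Data.Nat using (ℕ; zero; suc; _<_; _≤′_; ≤′-refl; ≤′-step)
open import Data.Nat.Properties using (≤-refl; ≤⇒≤′)
open import Data.Product using (∃; ∃₂; _×_; _,_; proj₁; proj₂)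
open import Data.List using (List; length; lookup)
open import Data.List.Membership.Propositional using (_∈_)
open import Data.List.Relation.Unary.Any using (index)
open import Data.List.Relation.Unary.Any.Properties using (lookup-index)
open import Data.Fin as Fin using (Fin; toℕ)
open import Data.Fin.Properties using (pigeonhole)
open import Data.Empty using (⊥-elim)
open import Relation.Nullary using (¬_; yes; no)
open import Relation.Binary.PropositionalEquality using (_≡_; sym; subst; cong)
open Relation.Binary.PropositionalEquality.≡-Reasoning
open import Axiom.ExcludedMiddle using (ExcludedMiddle)
open import Level using (0ℓ)

sequence-in-list-repeats : {X : Set} (l : List X) (f : ℕ → X) →
  (∀ n → f n ∈ l) → ∃₂ λ i j → i < j × f i ≡ f j
sequence-in-list-repeats l f f∈l =
  from-collision (pigeonhole (≤-refl {suc (length l)}) position)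
  where
  position : Fin (suc (length l)) → Fin (length l)
  position k = index (f∈l (toℕ k))

  from-collision : (∃₂ λ i j → i Fin.< j × position i ≡ position j) →
    ∃₂ λ i j → i < j × f i ≡ f j
  from-collision (i , j , i<j , same-position) = toℕ i , toℕ j , i<j , (begin
    f (toℕ i)              ≡⟨ lookup-index (f∈l (toℕ i)) ⟩
    lookup l (position i)  ≡⟨ cong (lookup l) same-position ⟩
    lookup l (position j)  ≡⟨ sym (lookup-index (f∈l (toℕ j))) ⟩
    f (toℕ j)              ∎)

module Run (A : ALF) (T : ALF.C A → Set)
  (O : ComplexityOrdering (ALF.H A)) (lam : Learner A) (occam : IsOccam A O lam)
  (τ : ALF.H A → ALF.S A) (teacher : IsTeacher A T τ) where
  open ALF A using (H; S; γ; κ; κ-⊥; κ-⊔→; κ-⊔←)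
  open ComplexityOrdering O using (_⪯_; ⪯-finite)
  open IsTeacher teacher using (progress-out; honesty)

  sample : ℕ → S
  sample = sampleSeq A τ lam

  proposal : ℕ → H
  proposal n = lam (sample n)

  targets-consistent : ∀ n c → T c → κ (sample n) c
  targets-consistent zero    c t = κ-⊥ c
  targets-consistent (suc n) c t =
    κ-⊔← (sample n) _ c (targets-consistent n c t , honesty _ c t)

  consistent-earlier : ∀ {n m} → n ≤′ m → ∀ c → κ (sample m) c → κ (sample n) c
  consistent-earlier ≤′-refl        c k = k
  consistent-earlier (≤′-step n≤m) c k =
    consistent-earlier n≤m c (proj₁ (κ-⊔→ _ _ c k))

  non-target-refuted : ∀ {i j} → i < j → ¬ T (γ (proposal i)) →
    ¬ κ (sample j) (γ (proposal i))
  non-target-refuted {i} i<j nt k =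
    progress-out _ nt (proj₂ (κ-⊔→ (sample i) _ _
      (consistent-earlier (≤⇒≤′ i<j) _ k)))

  sample-realizable : ∀ {h*} → T (γ h*) → ∀ n → Realizable A (sample n)
  sample-realizable {h*} t n = h* , targets-consistent n (γ h*) t

  proposal-below-target : ∀ {h*} → T (γ h*) → ∀ n → proposal n ⪯ h*
  proposal-below-target t n =
    proj₂ occam (sample n) (sample-realizable t n) _ (targets-consistent n _ t)

  -- A hypothesis proposed at two different times cannot be a non-target:
  -- the later proposal is consistent, while the earlier one is refuted.
  repeated-proposal-not-non-target : ∀ {h*} → T (γ h*) → ∀ {i j} → i < j →
    proposal i ≡ proposal j → ¬ ¬ T (γ (proposal i))
  repeated-proposal-not-non-target t {j = j} i<j same nt =
    non-target-refuted i<j nt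
      (subst (λ h → κ (sample j) (γ h)) (sym same)
        (proj₁ occam (sample j) (sample-realizable t j)))

  -- All proposals lie in the finite down-set of h*, so one repeats.
  proposal-repeats : ∀ {h*} → T (γ h*) →
    ∃₂ λ i j → i < j × proposal i ≡ proposal j
  proposal-repeats {h*} t with l , below⇒∈ ← ⪯-finite h* =
    sequence-in-list-repeats l proposal
      (λ n → below⇒∈ (proposal n) (proposal-below-target t n))

theorem2 : ExcludedMiddle 0ℓ →
    (A : ALF) → (T : ALF.C A → Set) → TargetRealizable A T →
    (O : ComplexityOrdering (ALF.H A)) → (lam : Learner A) → IsOccam A O lam →
    (τ : ALF.H A → ALF.S A) → IsTeacher A T τ →
    ∃ λ (n : ℕ) →
    T (ALF.γ A (lam (sampleSeq A τ lam n))) ×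
    ¬ (∃ λ (H′ : ALF.H A) →
    T (ALF.γ A H′) ×
    ComplexityOrdering._⪯_ O H′ (lam (sampleSeq A τ lam n)) ×
    ¬ ComplexityOrdering._⪯_ O (lam (sampleSeq A τ lam n)) H′)
theorem2 em A T (h* , t) O lam occam τ teacher = converged-run
  where
  open Run A T O lam occam τ teacher
  open ComplexityOrdering O using (_⪯_)

  converged-run : ∃ λ n → T (ALF.γ A (proposal n)) ×
    ¬ (∃ λ H′ → T (ALF.γ A H′) × H′ ⪯ proposal n × ¬ proposal n ⪯ H′)
  converged-run with i , j , i<j , same ← proposal-repeats t
    with em {T (ALF.γ A (proposal i))}
  ... | no nt  = ⊥-elim (repeated-proposal-not-non-target t i<j same nt)
  ... | yes ti = i , ti , λ (H′ , tH′ , _ , not-below) →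
                   not-below (proposal-below-target tH′ i)
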